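{- Let $L$ be a frame and $Q$ a unital involutive quantale such that $b=b^2=b^*$ for all $b\le e_Q$. Let $h:L\to{\downarrow}e_Q$ be a frame homomorphism and let $a\in Q$. Then there is exactly one homomorphism of unital involutive quantales $\vartheta:\mathcal{T}(L)\to Q$ such that $\vartheta(x)=h(x)$ for all $x\in L=L^{(\varepsilon)}$ and $\vartheta(\bar\alpha)=a$.
   Context: A quantale is a complete lattice with an associative multiplication distributing over arbitrary joins in each variable; unital with unit $e$; involutive with join-preserving $a\mapsto a^*$, $(ab)^*=b^*a^*$, $a^{**}=a$. Homomorphisms of unital involutive quantales preserve arbitrary joins, multiplication, unit and involution. Under the hypothesis, ${\downarrow}e_Q=\{b\mid b\le e_Q\}$ is a frame; a frame homomorphism preserves finite meets and arbitrary joins. Let $I$ be the free involutive monoid on one generator $\alpha$ (words in $\alpha,\alpha^*$, unit $\varepsilon$). For $w\in I$, $L^{(w)}=L^{\otimes(|w|+1)}$ (sup-lattice tensor product; $L^{(\varepsilon)}=L$) and $\mathcal{T}(L)=\bigoplus_{w\in I}L^{(w)}$ (sup-lattice direct sum), a unital involutive quantale with product given on pure tensors by $(x_0\otimes\cdots\otimes x_n)(y_0\otimes\cdots\otimes y_m)=x_0\otimes\cdots\otimes(x_n\wedge y_0)\otimes\cdots\otimes y_m$ (in degree $ww'$), unit $1_L\in L^{(\varepsilon)}$, and involution $x_0\otimes\cdots\otimes x_n\mapsto x_n\otimes\cdots\otimes x_0$ from $L^{(w)}$ to $L^{(w^*)}$. $\bar\alpha=1_L\otimes1_L\in L^{(\alpha)}$.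 -}

module Defs where

open import Level using (Level; _⊔_; suc; Lift; lift)
open import Data.Nat using (ℕ) renaming (suc to sucℕ)
open import Data.Fin using (Fin)
open import Data.Vec using (Vec; []; _∷_; lookup; _[_]≔_; reverse)
open import Data.List using (List; []; _∷_; _++_; [_]; length)
open import Data.List.Properties using (length-++)
open import Data.Nat.Properties using (+-comm)
open import Data.Product using (Σ; _×_; _,_)
open import Relation.Binary.PropositionalEquality using (_≡_; refl; sym; trans; cong; subst)

-- Frames.  Joins are indexed by types in Set ℓ (predicative reading of
-- "arbitrary joins"); equality of elements is propositional equality.

record Frame (ℓ : Level) : Set (suc ℓ) where
  infix 4 _≤_
  infixr 7 _∧_
  field
    Carrier  : Set ℓ
    _≤_      : Carrier → Carrier → Set ℓ
    ≤-refl   : ∀ {x} → x ≤ x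
    ≤-trans  : ∀ {x y z} → x ≤ y → y ≤ z → x ≤ z
    ≤-antisym : ∀ {x y} → x ≤ y → y ≤ x → x ≡ y
    ⋁        : {I : Set ℓ} → (I → Carrier) → Carrier
    ⋁-ub     : {I : Set ℓ} (f : I → Carrier) (i : I) → f i ≤ ⋁ f
    ⋁-least  : {I : Set ℓ} (f : I → Carrier) (x : Carrier) → (∀ i → f i ≤ x) → ⋁ f ≤ x
    _∧_      : Carrier → Carrier → Carrier
    ∧-lb₁    : ∀ x y → x ∧ y ≤ x
    ∧-lb₂    : ∀ x y → x ∧ y ≤ y
    ∧-glb    : ∀ x y z → z ≤ x → z ≤ y → z ≤ x ∧ y
    ⊤        : Carrier
    ⊤-max    : ∀ x → x ≤ ⊤
    ∧-distrib-⋁ : ∀ x {I : Set ℓ} (f : I → Carrier) → x ∧ ⋁ f ≡ ⋁ (λ i → x ∧ f i)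

record UIQuantale (ι q : Level) : Set (suc (ι ⊔ q)) where
  infix 4 _≤_
  infixl 7 _·_
  infix 8 _*
  field
    Carrier  : Set q
    _≤_      : Carrier → Carrier → Set q
    ≤-refl   : ∀ {x} → x ≤ x
    ≤-trans  : ∀ {x y z} → x ≤ y → y ≤ z → x ≤ z
    ≤-antisym : ∀ {x y} → x ≤ y → y ≤ x → x ≡ y
    ⋁        : {I : Set ι} → (I → Carrier) → Carrier
    ⋁-ub     : {I : Set ι} (f : I → Carrier) (i : I) → f i ≤ ⋁ f
    ⋁-least  : {I : Set ι} (f : I → Carrier) (x : Carrier) → (∀ i → f i ≤ x) → ⋁ f ≤ x
    _·_      : Carrier → Carrier → Carrier
    ·-assoc  : ∀ a b c → (a · b) · c ≡ a · (b · c)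
    ·-distribˡ-⋁ : ∀ a {I : Set ι} (f : I → Carrier) → a · ⋁ f ≡ ⋁ (λ i → a · f i)
    ·-distribʳ-⋁ : ∀ a {I : Set ι} (f : I → Carrier) → ⋁ f · a ≡ ⋁ (λ i → f i · a)
    e        : Carrier
    e-identityˡ : ∀ a → e · a ≡ a
    e-identityʳ : ∀ a → a · e ≡ a
    _*       : Carrier → Carrier
    *-⋁      : {I : Set ι} (f : I → Carrier) → (⋁ f) * ≡ ⋁ (λ i → f i *)
    *-·      : ∀ a b → (a · b) * ≡ b * · a *
    *-*      : ∀ a → a * * ≡ a

-- The free involutive monoid I on one generator α.

data Letter : Set where
  α α* : Letter

swapL : Letter → Letter
swapL α  = α*
swapL α* = α

Word : Set
Word = List Letter

ε : Word
ε = []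

star : Word → Word
star []      = []
star (c ∷ w) = star w ++ [ swapL c ]

length-star : ∀ w → length (star w) ≡ length w
length-star []      = refl
length-star (c ∷ w) =
  trans (length-++ (star w)) (trans (+-comm (length (star w)) 1) (cong sucℕ (length-star w)))

-- The quantale 𝒯(L) = ⨁_{w ∈ I} L^{⊗(|w|+1)}.
--
-- An element of L^{⊗n} is presented by a subset S of L^n (standing for
-- the join of the pure tensors x₀⊗…⊗x_{n-1}, x ∈ S); two presentations
-- are equal iff they generate the same tensor ideal (down-closed subset
-- closed under joins in each coordinate).  An element of the direct sum
-- is a family (w ↦ subset of L^{(w)}).

module Tensor {ℓ : Level} (L : Frame ℓ) where
  open Frame L

  Tup : Word → Set ℓ
  Tup w = Vec Carrier (sucℕ (length w))

  _≤ᵥ_ : ∀ {n} → Vec Carrier n → Vec Carrier n → Set ℓ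
  y ≤ᵥ x = ∀ i → lookup y i ≤ lookup x i

  data Gen {n : ℕ} (R : Vec Carrier n → Set (suc ℓ)) : Vec Carrier n → Set (suc ℓ) where
    base : ∀ {x} → R x → Gen R x
    down : ∀ {x y} → y ≤ᵥ x → Gen R x → Gen R y
    join : (x : Vec Carrier n) (i : Fin n) {I : Set ℓ} (f : I → Carrier) →
           (∀ j → Gen R (x [ i ]≔ f j)) → Gen R (x [ i ]≔ ⋁ f)

  TL : Set (suc (suc ℓ))
  TL = (w : Word) → Tup w → Set (suc ℓ)

  infix 4 _≤T_ _≈T_
  _≤T_ : TL → TL → Set (suc ℓ)
  S ≤T S' = ∀ w x → S w x → Gen (S' w) x

  _≈T_ : TL → TL → Set (suc ℓ)
  S ≈T S' = (S ≤T S') × (S' ≤T S)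

  ⋁T : {I : Set (suc ℓ)} → (I → TL) → TL
  ⋁T {I} f w x = Σ I (λ i → f i w x)

  -- product of pure tensors: x₀⊗…⊗(x_n ∧ y₀)⊗…⊗y_m in degree ww'
  glue : (w w' : Word) → Tup w → Tup w' → Tup (w ++ w')
  glue []      w' (x ∷ []) (y ∷ ys) = (x ∧ y) ∷ ys
  glue (c ∷ w) w' (x ∷ xs) ys       = x ∷ glue w w' xs ys

  data _·T_ (S S' : TL) : TL where
    mk : ∀ {w w' x y} → S w x → S' w' y → (S ·T S') (w ++ w') (glue w w' x y)

  revT : (w : Word) → Tup w → Tup (star w)
  revT w x = subst (λ m → Vec Carrier (sucℕ m)) (sym (length-star w)) (reverse x)

  data _*T (S : TL) : TL where
    mk : ∀ {w x} → S w x → (S *T) (star w) (revT w x)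

  data Single (w₀ : Word) (x₀ : Tup w₀) : TL where
    here : Single w₀ x₀ w₀ x₀

  embed : Carrier → TL
  embed x = Single ε (x ∷ [])

  eT : TL
  eT = embed ⊤

  ᾱ : TL
  ᾱ = Single (α ∷ []) (⊤ ∷ ⊤ ∷ [])

  record IsUIQHom {q : Level} (Q : UIQuantale (suc ℓ) q) (θ : TL → UIQuantale.Carrier Q)
         : Set (suc (suc ℓ) ⊔ q) where
    module Q = UIQuantale Q
    field
      θ-cong : ∀ {S S'} → S ≈T S' → θ S ≡ θ S'
      θ-⋁    : {I : Set (suc ℓ)} (f : I → TL) → θ (⋁T f) ≡ Q.⋁ (λ i → θ (f i))
      θ-·    : ∀ S S' → θ (S ·T S') ≡ θ S Q.· θ S'
      θ-e    : θ eT ≡ Q.e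
      θ-*    : ∀ S → θ (S *T) ≡ θ S Q.*

-- Frame homomorphisms L → ↓e_Q (joins and meets of ↓e_Q computed in ↓e_Q;
-- ↓e_Q-joins of elements ≤ e are their Q-joins).

record IsFrameHomToDownE {ℓ q : Level} (L : Frame ℓ) (Q : UIQuantale (suc ℓ) q)
       (h : Frame.Carrier L → UIQuantale.Carrier Q) : Set (suc ℓ ⊔ q) where
  module L = Frame L
  module Q = UIQuantale Q
  field
    h-below : ∀ x → h x Q.≤ Q.e
    h-⊤     : h L.⊤ ≡ Q.e
    h-∧     : ∀ x y → (h (x L.∧ y) Q.≤ h x) × (h (x L.∧ y) Q.≤ h y) ×
              (∀ z → z Q.≤ Q.e → z Q.≤ h x → z Q.≤ h y → z Q.≤ h (x L.∧ y))
    h-⋁     : {I : Set ℓ} (f : I → L.Carrier) →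
              h (L.⋁ f) ≡ Q.⋁ {Lift (suc ℓ) I} (λ i → h (f (Lift.lower i)))

-- In 𝒯(L) every element is the join of its pure tensors, and a pure tensor of degree
-- c₁ ⋯ cₙ factors as x₀ ⊗ ⋯ ⊗ xₙ = x₀ · ĉ₁ · x₁ ⋯ ĉₙ · xₙ with α̂ = ᾱ and α*̂ = ᾱ*.
-- So ϑ is forced, without any hypothesis on Q: it sends x₀ ⊗ ⋯ ⊗ xₙ to
-- φ(x) = h x₀ · g c₁ · h x₁ ⋯ g cₙ · h xₙ (g α = a, g α* = a*), and S to the join of φ over
-- the pure tensors presenting S.  That this ϑ is a homomorphism rests on the elements
-- below e being projections: then h (x ∧ y) = h x · h y, which is what the product
-- x₀ ⊗ ⋯ ⊗ (xₙ ∧ y₀) ⊗ ⋯ ⊗ yₘ requires, and h x * = h x, which makes φ commute with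
-- the involution.  Since φ is monotone and preserves joins in each coordinate, ϑ does
-- not depend on the presentation.
module Submission where

open import Defs
open import Level using (Level; suc; Lift; lift; lower)
open import Data.Bool using (Bool; true; false)
open import Data.Product using (Σ; _×_; _,_; proj₁; proj₂)
open import Data.Nat using () renaming (suc to sucℕ)
open import Data.Nat.Properties using (suc-injective)
open import Data.Fin using (zero) renaming (suc to fsuc)
open import Data.List using (List; []; _∷_; _++_; [_]; length; reverse)
open import Data.List.Properties using (unfold-reverse; length-reverse)
open import Data.Vec using (Vec; []; _∷_; _[_]≔_; toList) renaming (reverse to reverseᵥ)
open import Data.Vec.Properties using (toList-reverse; length-toList)
open import Relation.Binary.PropositionalEquality
  using (_≡_; refl; sym; trans; cong; cong₂; subst; module ≡-Reasoning)

module FrameProperties {ℓ : Level} (L : Frame ℓ) where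
  open Frame L

  ∧-identityʳ : ∀ x → x ∧ ⊤ ≡ x
  ∧-identityʳ x = ≤-antisym (∧-lb₁ x ⊤) (∧-glb x ⊤ x ≤-refl (⊤-max x))

  ∧-identityˡ : ∀ x → ⊤ ∧ x ≡ x
  ∧-identityˡ x = ≤-antisym (∧-lb₂ ⊤ x) (∧-glb ⊤ x x (⊤-max x) ≤-refl)

  x≤y⇒x∧y≡x : ∀ {x y} → x ≤ y → x ∧ y ≡ x
  x≤y⇒x∧y≡x {x} {y} x≤y = ≤-antisym (∧-lb₁ x y) (∧-glb x y x ≤-refl x≤y)

module QuantaleProperties {ι q : Level} (Q : UIQuantale ι q) where
  open UIQuantale Q

  ≤-reflexive : ∀ {x y} → x ≡ y → x ≤ y
  ≤-reflexive refl = ≤-refl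

  ⋁-cong : ∀ {I : Set ι} {f g : I → Carrier} → (∀ i → f i ≡ g i) → ⋁ f ≡ ⋁ g
  ⋁-cong {f = f} {g} f≡g = ≤-antisym
    (⋁-least f _ λ i → subst (_≤ ⋁ g) (sym (f≡g i)) (⋁-ub g i))
    (⋁-least g _ λ i → subst (_≤ ⋁ f) (f≡g i) (⋁-ub f i))

  private
    pair : Carrier → Carrier → Lift ι Bool → Carrier
    pair x y (lift true)  = x
    pair x y (lift false) = y

    x≤y⇒⋁pair≡y : ∀ {x y} → x ≤ y → ⋁ (pair x y) ≡ y
    x≤y⇒⋁pair≡y {x} {y} x≤y = ≤-antisym
      (⋁-least _ _ λ { (lift true) → x≤y ; (lift false) → ≤-refl })
      (⋁-ub (pair x y) (lift false))

    ⋁-preserving⇒mono : (f : Carrier → Carrier) →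
                        (∀ {I : Set ι} (u : I → Carrier) → f (⋁ u) ≡ ⋁ (λ i → f (u i))) →
                        ∀ {x y} → x ≤ y → f x ≤ f y
    ⋁-preserving⇒mono f f-⋁ {x} {y} x≤y =
      subst (λ z → f x ≤ f z) (x≤y⇒⋁pair≡y x≤y)
        (subst (f x ≤_) (sym (f-⋁ (pair x y))) (⋁-ub (λ i → f (pair x y i)) (lift true)))

  ·-monoˡ : ∀ {x y} c → x ≤ y → x · c ≤ y · c
  ·-monoˡ c = ⋁-preserving⇒mono (_· c) (·-distribʳ-⋁ c)

  ·-monoʳ : ∀ {x y} c → x ≤ y → c · x ≤ c · y
  ·-monoʳ c = ⋁-preserving⇒mono (c ·_) (·-distribˡ-⋁ c)

  ·-mono : ∀ {x y x' y'} → x ≤ x' → y ≤ y' → x · y ≤ x' · y'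
  ·-mono {y = y} {x'} x≤x' y≤y' = ≤-trans (·-monoˡ y x≤x') (·-monoʳ x' y≤y')

  *-mono : ∀ {x y} → x ≤ y → x * ≤ y *
  *-mono = ⋁-preserving⇒mono _* *-⋁

  ⋁·⋁-least : ∀ {I J : Set ι} (f : I → Carrier) (g : J → Carrier) c →
              (∀ i j → f i · g j ≤ c) → ⋁ f · ⋁ g ≤ c
  ⋁·⋁-least f g c fg≤c =
    subst (_≤ c) (sym (·-distribʳ-⋁ (⋁ g) f))
      (⋁-least _ _ λ i → subst (_≤ c) (sym (·-distribˡ-⋁ (f i) g)) (⋁-least _ _ (fg≤c i)))

  ⋁*-least : ∀ {I : Set ι} (f : I → Carrier) c → (∀ i → f i * ≤ c) → (⋁ f) * ≤ c
  ⋁*-least f c f*≤c = subst (_≤ c) (sym (*-⋁ f)) (⋁-least _ _ f*≤c)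

SubunitsAreProjections : {ι q : Level} → UIQuantale ι q → Set q
SubunitsAreProjections Q =
  ∀ b → b ≤ e → (b ≡ b · b) × (b ≡ b *)
  where open UIQuantale Q

module FrameHomToDownEProperties {ℓ q : Level} (L : Frame ℓ) (Q : UIQuantale (suc ℓ) q)
  (projections : SubunitsAreProjections Q)
  (h : Frame.Carrier L → UIQuantale.Carrier Q) (h-hom : IsFrameHomToDownE L Q h) where

  private module L = Frame L
  open UIQuantale Q
  open QuantaleProperties Q
  open IsFrameHomToDownE h-hom using (h-below; h-∧)

  h-mono : ∀ {x y} → x L.≤ y → h x ≤ h y
  h-mono {x} {y} x≤y =
    subst (λ z → h z ≤ h y) (FrameProperties.x≤y⇒x∧y≡x L x≤y) (proj₁ (proj₂ (h-∧ x y)))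

  h-selfAdjoint : ∀ x → h x * ≡ h x
  h-selfAdjoint x = sym (proj₂ (projections (h x) (h-below x)))

  -- Below e the product is the meet: b · c ≤ b · e = b, and d = d · d ≤ b · c for d ≤ b, c.
  h-∧≡· : ∀ x y → h (x L.∧ y) ≡ h x · h y
  h-∧≡· x y = ≤-antisym
    (subst (_≤ h x · h y) (sym (proj₁ (projections _ (h-below (x L.∧ y)))))
       (·-mono h-∧≤hx h-∧≤hy))
    (∧-greatest _
       (subst (h x · h y ≤_) (e-identityʳ e) (·-mono (h-below x) (h-below y)))
       (subst (h x · h y ≤_) (e-identityʳ (h x)) (·-monoʳ (h x) (h-below y)))
       (subst (h x · h y ≤_) (e-identityˡ (h y)) (·-monoˡ (h y) (h-below x))))
    where
    h-∧≤hx : h (x L.∧ y) ≤ h x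
    h-∧≤hx = proj₁ (h-∧ x y)
    h-∧≤hy : h (x L.∧ y) ≤ h y
    h-∧≤hy = proj₁ (proj₂ (h-∧ x y))
    ∧-greatest : ∀ z → z ≤ e → z ≤ h x → z ≤ h y → z ≤ h (x L.∧ y)
    ∧-greatest = proj₂ (proj₂ (h-∧ x y))

module Evaluation {ℓ q : Level} (L : Frame ℓ) (Q : UIQuantale (suc ℓ) q)
  (h : Frame.Carrier L → UIQuantale.Carrier Q) (a : UIQuantale.Carrier Q) where

  private module L = Frame L
  open UIQuantale Q
  open Tensor L

  g : Letter → Carrier
  g α  = a
  g α* = a *

  -- Only lists of length |w| + 1 matter; on other lengths the value is junk.
  ev : Word → List L.Carrier → Carrier
  ev w       []       = e
  ev []      (x ∷ _)  = h x
  ev (c ∷ w) (x ∷ xs) = h x · (g c · ev w xs)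

  φ : (w : Word) → Tup w → Carrier
  φ w x = ev w (toList x)

  PureTensor : TL → Set (suc ℓ)
  PureTensor S = Σ Word λ w → Σ (Tup w) λ x → S w x

  θ : TL → Carrier
  θ S = ⋁ {PureTensor S} λ { (w , x , _) → φ w x }

  θ-ub : ∀ {S w x} → S w x → φ w x ≤ θ S
  θ-ub {w = w} {x} s = ⋁-ub _ (w , x , s)

  θ-least : ∀ {S} c → (∀ {w x} → S w x → φ w x ≤ c) → θ S ≤ c
  θ-least c φ≤c = ⋁-least _ c λ { (_ , _ , s) → φ≤c s }

  θ-Single : ∀ w x → θ (Single w x) ≡ φ w x
  θ-Single w x = ≤-antisym (θ-least _ λ { here → ≤-refl }) (θ-ub here)

module Extension {ℓ q : Level} (L : Frame ℓ) (Q : UIQuantale (suc ℓ) q)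
  (projections : SubunitsAreProjections Q)
  (h : Frame.Carrier L → UIQuantale.Carrier Q) (h-hom : IsFrameHomToDownE L Q h)
  (a : UIQuantale.Carrier Q) where

  private module L = Frame L
  open UIQuantale Q
  open QuantaleProperties Q
  open FrameHomToDownEProperties L Q projections h h-hom
  open IsFrameHomToDownE h-hom using (h-⊤; h-⋁)
  open Tensor L
  open Evaluation L Q h a

  ev-∧-head : ∀ w x y zs → ev w ((x L.∧ y) ∷ zs) ≡ h x · ev w (y ∷ zs)
  ev-∧-head []      x y zs = h-∧≡· x y
  ev-∧-head (c ∷ w) x y zs =
    trans (cong (_· (g c · ev w zs)) (h-∧≡· x y)) (·-assoc _ _ _)

  ev-⋁-head : ∀ w {I : Set ℓ} (f : I → L.Carrier) zs →
              ev w (L.⋁ f ∷ zs) ≡ ⋁ {Lift (suc ℓ) I} (λ j → ev w (f (lower j) ∷ zs))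
  ev-⋁-head []      f zs = h-⋁ f
  ev-⋁-head (c ∷ w) f zs =
    trans (cong (_· (g c · ev w zs)) (h-⋁ f)) (·-distribʳ-⋁ _ _)

  ev-snoc : ∀ u ys y c → length ys ≡ sucℕ (length u) →
            ev (u ++ [ c ]) (ys ++ [ y ]) ≡ ev u ys · (g c · h y)
  ev-snoc []       (y₀ ∷ []) y c _  = refl
  ev-snoc (c₀ ∷ u) (y₀ ∷ ys) y c eq = begin
      h y₀ · (g c₀ · ev (u ++ [ c ]) (ys ++ [ y ]))
    ≡⟨ cong (λ z → h y₀ · (g c₀ · z)) (ev-snoc u ys y c (suc-injective eq)) ⟩
      h y₀ · (g c₀ · (ev u ys · (g c · h y)))
    ≡⟨ cong (h y₀ ·_) (sym (·-assoc _ _ _)) ⟩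
      h y₀ · ((g c₀ · ev u ys) · (g c · h y))
    ≡⟨ sym (·-assoc _ _ _) ⟩
      (h y₀ · (g c₀ · ev u ys)) · (g c · h y) ∎
    where open ≡-Reasoning

  g-swapL : ∀ c → g (swapL c) ≡ g c *
  g-swapL α  = refl
  g-swapL α* = sym (*-* a)

  ev-star : ∀ w xs → length xs ≡ sucℕ (length w) → ev (star w) (reverse xs) ≡ ev w xs *
  ev-star []      (x ∷ [])  _  = sym (h-selfAdjoint x)
  ev-star (c ∷ w) (x ∷ xs)  eq = begin
      ev (star w ++ [ swapL c ]) (reverse (x ∷ xs))
    ≡⟨ cong (ev (star w ++ [ swapL c ])) (unfold-reverse x xs) ⟩
      ev (star w ++ [ swapL c ]) (reverse xs ++ [ x ])
    ≡⟨ ev-snoc (star w) (reverse xs) x (swapL c) length-reverse-xs ⟩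
      ev (star w) (reverse xs) · (g (swapL c) · h x)
    ≡⟨ cong₂ (λ u v → u · (v · h x)) (ev-star w xs (suc-injective eq)) (g-swapL c) ⟩
      ev w xs * · (g c * · h x)
    ≡⟨ cong (λ z → ev w xs * · (g c * · z)) (sym (h-selfAdjoint x)) ⟩
      ev w xs * · (g c * · h x *)
    ≡⟨ sym (·-assoc _ _ _) ⟩
      (ev w xs * · g c *) · h x *
    ≡⟨ cong (_· h x *) (sym (*-· (g c) (ev w xs))) ⟩
      (g c · ev w xs) * · h x *
    ≡⟨ sym (*-· (h x) (g c · ev w xs)) ⟩
      (h x · (g c · ev w xs)) * ∎
    where
    open ≡-Reasoning
    length-reverse-xs : length (reverse xs) ≡ sucℕ (length (star w))
    length-reverse-xs = trans (length-reverse xs)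
      (trans (suc-injective eq) (cong sucℕ (sym (length-star w))))

  φ-glue : ∀ w w' (x : Tup w) (y : Tup w') → φ (w ++ w') (glue w w' x y) ≡ φ w x · φ w' y
  φ-glue []      w' (x ∷ []) (y ∷ ys) = ev-∧-head w' x y (toList ys)
  φ-glue (c ∷ w) w' (x ∷ xs) ys       = begin
      h x · (g c · φ (w ++ w') (glue w w' xs ys))
    ≡⟨ cong (λ z → h x · (g c · z)) (φ-glue w w' xs ys) ⟩
      h x · (g c · (φ w xs · φ w' ys))
    ≡⟨ cong (h x ·_) (sym (·-assoc _ _ _)) ⟩
      h x · ((g c · φ w xs) · φ w' ys)
    ≡⟨ sym (·-assoc _ _ _) ⟩
      (h x · (g c · φ w xs)) · φ w' ys ∎
    where open ≡-Reasoning

  toList-substLength : ∀ {m n} (m≡n : m ≡ n) (v : Vec L.Carrier (sucℕ m)) →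
                       toList (subst (λ k → Vec L.Carrier (sucℕ k)) m≡n v) ≡ toList v
  toList-substLength refl v = refl

  φ-revT : ∀ w (x : Tup w) → φ (star w) (revT w x) ≡ φ w x *
  φ-revT w x = trans
    (cong (ev (star w)) (trans (toList-substLength (sym (length-star w)) (reverseᵥ x))
                               (toList-reverse x)))
    (ev-star w (toList x) (length-toList x))

  φ-mono : ∀ w (x y : Tup w) → x ≤ᵥ y → φ w x ≤ φ w y
  φ-mono []      (x ∷ [])  (y ∷ [])  x≤y = h-mono (x≤y zero)
  φ-mono (c ∷ w) (x ∷ xs) (y ∷ ys) x≤y =
    ·-mono (h-mono (x≤y zero)) (·-monoʳ (g c) (φ-mono w xs ys (λ i → x≤y (fsuc i))))

  φ-join : ∀ w (x : Tup w) i {I : Set ℓ} (f : I → L.Carrier) →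
           φ w (x [ i ]≔ L.⋁ f) ≤ ⋁ {Lift (suc ℓ) I} (λ j → φ w (x [ i ]≔ f (lower j)))
  φ-join w       (x ∷ xs) zero    f = ≤-reflexive (ev-⋁-head w f (toList xs))
  φ-join (c ∷ w) (x ∷ xs) (fsuc i) f =
    ≤-trans (·-monoʳ (h x) (·-monoʳ (g c) (φ-join w xs i f)))
      (≤-reflexive (trans (cong (h x ·_) (·-distribˡ-⋁ (g c) _)) (·-distribˡ-⋁ (h x) _)))

  φ≤θ-Gen : ∀ S w {x} → Gen (S w) x → φ w x ≤ θ S
  φ≤θ-Gen S w (base s)             = θ-ub s
  φ≤θ-Gen S w (down {x} {y} y≤x G) = ≤-trans (φ-mono w y x y≤x) (φ≤θ-Gen S w G)
  φ≤θ-Gen S w (join x i f G)       =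
    ≤-trans (φ-join w x i f) (⋁-least _ _ λ j → φ≤θ-Gen S w (G (lower j)))

  θ-mono : ∀ {S S'} → S ≤T S' → θ S ≤ θ S'
  θ-mono {S' = S'} S≤S' = θ-least _ λ {w} {x} s → φ≤θ-Gen S' w (S≤S' w x s)

  θ-isUIQHom : IsUIQHom Q θ
  θ-isUIQHom = record
    { θ-cong = λ (S≤S' , S'≤S) → ≤-antisym (θ-mono S≤S') (θ-mono S'≤S)
    ; θ-⋁    = θ-⋁
    ; θ-·    = θ-·
    ; θ-e    = trans (θ-Single ε (L.⊤ ∷ [])) h-⊤
    ; θ-*    = θ-*
    }
    where
    θ-⋁ : {I : Set (suc ℓ)} (f : I → TL) → θ (⋁T f) ≡ ⋁ (λ i → θ (f i))
    θ-⋁ f = ≤-antisym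
      (θ-least _ λ { (i , s) → ≤-trans (θ-ub s) (⋁-ub (λ i → θ (f i)) i) })
      (⋁-least _ _ λ i → θ-least _ λ s → θ-ub (i , s))

    θ-· : ∀ S S' → θ (S ·T S') ≡ θ S · θ S'
    θ-· S S' = ≤-antisym
      (θ-least _ λ { (mk {w} {w'} {x} {y} s s') →
         subst (_≤ θ S · θ S') (sym (φ-glue w w' x y)) (·-mono (θ-ub s) (θ-ub s')) })
      (⋁·⋁-least _ _ _ λ { (w , x , s) (w' , y , s') →
         subst (_≤ θ (S ·T S')) (φ-glue w w' x y) (θ-ub (mk s s')) })

    θ-* : ∀ S → θ (S *T) ≡ θ S *
    θ-* S = ≤-antisym
      (θ-least _ λ { (mk {w} {x} s) → subst (_≤ θ S *) (sym (φ-revT w x)) (*-mono (θ-ub s)) })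
      (⋁*-least _ _ λ { (w , x , s) → subst (_≤ θ (S *T)) (φ-revT w x) (θ-ub (mk s)) })

  θ-embed : ∀ x → θ (embed x) ≡ h x
  θ-embed x = θ-Single ε (x ∷ [])

  θ-ᾱ : θ ᾱ ≡ a
  θ-ᾱ = begin
      θ ᾱ                        ≡⟨ θ-Single (α ∷ []) (L.⊤ ∷ L.⊤ ∷ []) ⟩
      h L.⊤ · (a · h L.⊤)        ≡⟨ cong₂ (λ u v → u · (a · v)) h-⊤ h-⊤ ⟩
      e · (a · e)                ≡⟨ trans (e-identityˡ _) (e-identityʳ a) ⟩
      a                          ∎
    where open ≡-Reasoning

module Uniqueness {ℓ q : Level} (L : Frame ℓ) (Q : UIQuantale (suc ℓ) q)
  (h : Frame.Carrier L → UIQuantale.Carrier Q) (a : UIQuantale.Carrier Q)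
  (θ' : Tensor.TL L → UIQuantale.Carrier Q) (θ'-hom : Tensor.IsUIQHom L Q θ')
  (θ'-embed : ∀ x → θ' (Tensor.embed L x) ≡ h x) (θ'-ᾱ : θ' (Tensor.ᾱ L) ≡ a) where

  private module L = Frame L
  open UIQuantale Q
  open QuantaleProperties Q
  open FrameProperties L
  open Tensor L
  open Evaluation L Q h a
  open IsUIQHom θ'-hom

  letter : Letter → TL
  letter α  = ᾱ
  letter α* = ᾱ *T

  θ'-letter : ∀ c → θ' (letter c) ≡ g c
  θ'-letter α  = θ'-ᾱ
  θ'-letter α* = trans (θ-* ᾱ) (cong _* θ'-ᾱ)

  Gen-≡ : ∀ {n} {R : Vec L.Carrier n → Set (suc ℓ)} {x y} → x ≡ y → Gen R x → Gen R y
  Gen-≡ refl G = G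

  ⊤-glue : ∀ {n} x₀ x₁ (xs : Vec L.Carrier n) →
           _≡_ {A = Vec L.Carrier (sucℕ (sucℕ n))} ((x₀ L.∧ L.⊤) ∷ (L.⊤ L.∧ x₁) ∷ xs) (x₀ ∷ x₁ ∷ xs)
  ⊤-glue x₀ x₁ xs = cong₂ (λ u v → u ∷ v ∷ xs) (∧-identityʳ x₀) (∧-identityˡ x₁)

  Single-∷ : ∀ c w x₀ (xs : Tup w) → Single (c ∷ w) (x₀ ∷ xs) ≈T (embed x₀ ·T (letter c ·T Single w xs))
  Single-∷ α  w x₀ (x₁ ∷ xs) =
    (λ { _ _ here → Gen-≡ (⊤-glue x₀ x₁ xs) (base (mk here (mk here here))) }) ,
    (λ { _ _ (mk here (mk here here)) → Gen-≡ (sym (⊤-glue x₀ x₁ xs)) (base here) })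
  Single-∷ α* w x₀ (x₁ ∷ xs) =
    (λ { _ _ here → Gen-≡ (⊤-glue x₀ x₁ xs) (base (mk here (mk (mk here) here))) }) ,
    (λ { _ _ (mk here (mk (mk here) here)) → Gen-≡ (sym (⊤-glue x₀ x₁ xs)) (base here) })

  θ'-Single : ∀ w (x : Tup w) → θ' (Single w x) ≡ φ w x
  θ'-Single []      (x₀ ∷ [])  = θ'-embed x₀
  θ'-Single (c ∷ w) (x₀ ∷ xs) = begin
      θ' (Single (c ∷ w) (x₀ ∷ xs))                  ≡⟨ θ-cong (Single-∷ c w x₀ xs) ⟩
      θ' (embed x₀ ·T (letter c ·T Single w xs))     ≡⟨ θ-· _ _ ⟩
      θ' (embed x₀) · θ' (letter c ·T Single w xs)   ≡⟨ cong (θ' (embed x₀) ·_) (θ-· _ _) ⟩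
      θ' (embed x₀) · (θ' (letter c) · θ' (Single w xs))
        ≡⟨ cong₂ (λ u v → u · (v · θ' (Single w xs))) (θ'-embed x₀) (θ'-letter c) ⟩
      h x₀ · (g c · θ' (Single w xs))                ≡⟨ cong (λ z → h x₀ · (g c · z)) (θ'-Single w xs) ⟩
      h x₀ · (g c · φ w xs)                          ∎
    where open ≡-Reasoning

  ≈T-⋁Single : ∀ S → S ≈T ⋁T {PureTensor S} (λ { (w , x , _) → Single w x })
  ≈T-⋁Single S = (λ w x s → base ((w , x , s) , here)) , (λ { _ _ ((_ , _ , s) , here) → base s })

  θ'≡θ : ∀ S → θ' S ≡ θ S
  θ'≡θ S = trans (θ-cong (≈T-⋁Single S))
    (trans (θ-⋁ _) (⋁-cong λ { (w , x , _) → θ'-Single w x }))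

mainTheorem10 : ∀ {ℓ q : Level} (L : Frame ℓ) (Q : UIQuantale (suc ℓ) q) →
    (∀ b → UIQuantale._≤_ Q b (UIQuantale.e Q) →
       (b ≡ UIQuantale._·_ Q b b) × (b ≡ UIQuantale._* Q b)) →
    (h : Frame.Carrier L → UIQuantale.Carrier Q) → IsFrameHomToDownE L Q h →
    (a : UIQuantale.Carrier Q) →
    Σ (Tensor.TL L → UIQuantale.Carrier Q) (λ θ →
       (Tensor.IsUIQHom L Q θ ×
        (∀ x → θ (Tensor.embed L x) ≡ h x) ×
        θ (Tensor.ᾱ L) ≡ a) ×
       ((θ' : Tensor.TL L → UIQuantale.Carrier Q) →
          Tensor.IsUIQHom L Q θ' →
          (∀ x → θ' (Tensor.embed L x) ≡ h x) →
          θ' (Tensor.ᾱ L) ≡ a →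
          (S : Tensor.TL L) → θ' S ≡ θ S))
mainTheorem10 L Q projections h h-hom a =
  θ , (θ-isUIQHom , θ-embed , θ-ᾱ) ,
  λ θ' θ'-hom θ'-embed θ'-ᾱ → Uniqueness.θ'≡θ L Q h a θ' θ'-hom θ'-embed θ'-ᾱ
  where
  open Evaluation L Q h a using (θ)
  open Extension L Q projections h h-hom a using (θ-isUIQHom; θ-embed; θ-ᾱ)
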